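{- Let $\mathcal{A}$ be a lazy paging algorithm. If $\mathcal{A}$ conforms to a family $\{\preceq_\sigma\}$ that is monotone and self-similar, then $\mathcal{A}$ is stable.
   Context: $\mathcal{U}$ is a totally ordered universe of items. $\mathcal{A}_k$ is paging algorithm $\mathcal{A}$ on an initially empty cache of size $k$; $\mathcal{A}_k(\sigma)$ is the set of cached items after serving $\sigma$; $\textsf{Out}(\mathcal{A}_k,\tau,z):=\mathcal{A}_k(\tau)\setminus\mathcal{A}_k(\tau z)$; for $X\subseteq\mathcal{U}$, $\sigma[X]$ is the subsequence of $\sigma$ of requests to items in $X$. Lazy: fetches only on a miss, evicts at most one item per miss, and only when full. $\{\preceq_\sigma\}_{\sigma\in\mathcal{U}^*}$ is a family of total orders on $\mathcal{U}$. $\mathcal{A}$ conforms to it if for every $\tau$, $z$, $k$: whenever $x\in\mathcal{A}_k(\tau)\setminus\textsf{Out}(\mathcal{A}_k,\tau,z)$ and $y\in\textsf{Out}(\mathcal{A}_k,\tau,z)$, then $x\preceq_{\tau z}y$. Monotone: for every $\sigma$ and items $x,y,z$ appearing in $\sigma$ with $y\neq z$, $x\preceq_\sigma y$ implies $x\preceq_{\sigma z}y$. Self-similar: for every $\sigma$, $X\subseteq\mathcal{U}$, and items $x,y$ appearing in $\sigma[X]$, $x\preceq_{\sigma[X]}y$ implies $x\preceq_\sigma y$. Stable: for every $\tau\in\mathcal{U}^*$, $X\subseteq\mathcal{U}$, $z\in X$, integers $a>b\ge1$, $\textsf{Out}(\mathcal{A}_b,\tau[X],z)\cap\mathcal{A}_a(\tau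 z)\neq\emptyset$ implies $\mathcal{A}_b(\tau[X]z)\subseteq\mathcal{A}_a(\tau z)$. -}

module Defs where

open import Level using (0ℓ)
open import Data.Nat using (ℕ; suc; _<_; _≥_; _>_)
open import Relation.Nullary using (¬_)
open import Data.Bool using (Bool; true; false; if_then_else_)
open import Data.List using (List; []; _∷_; _∷ʳ_; length)
open import Data.List.Membership.Propositional using (_∈_; _∉_)
open import Data.List.Relation.Unary.Unique.Propositional using (Unique)
open import Data.Product using (_×_; ∃; ∃-syntax)
open import Data.Sum using (_⊎_)
open import Relation.Binary.PropositionalEquality using (_≡_; _≢_)
open import Relation.Binary.Core using (Rel)
open import Relation.Binary.Structures using (IsTotalOrder)
open import Function.Bundles using (_⇔_)

-- A (deterministic) paging algorithm: for every cache size k and every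
-- request sequence σ, the list of items in the cache after serving σ
-- (starting from the empty cache).  The list is read as a finite set
-- (duplicate-freeness is required by `Lazy`).
PagingAlg : Set → Set
PagingAlg U = ℕ → List U → List U

Subset : Set → Set
Subset U = U → Bool

restrict : {U : Set} → List U → Subset U → List U
restrict [] X = []
restrict (x ∷ σ) X = if X x then x ∷ restrict σ X else restrict σ X

Out : {U : Set} → PagingAlg U → ℕ → List U → U → U → Set
Out A k τ z y = (y ∈ A k τ) × (y ∉ A k (τ ∷ʳ z))

record Lazy {U : Set} (A : PagingAlg U) : Set where
  field
    initial : ∀ k → A k [] ≡ []
    unique  : ∀ k σ → Unique (A k σ)
    hit     : ∀ k → k ≥ 1 → ∀ τ z → z ∈ A k τ →
              ∀ x → (x ∈ A k (τ ∷ʳ z)) ⇔ (x ∈ A k τ)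
    missNotFull : ∀ k → k ≥ 1 → ∀ τ z → z ∉ A k τ → length (A k τ) < k →
              ∀ x → (x ∈ A k (τ ∷ʳ z)) ⇔ ((x ∈ A k τ) ⊎ (x ≡ z))
    missFull : ∀ k → k ≥ 1 → ∀ τ z → z ∉ A k τ → length (A k τ) ≡ k →
              ∃[ y ] ((y ∈ A k τ) ×
                (∀ x → (x ∈ A k (τ ∷ʳ z)) ⇔ (((x ∈ A k τ) × (x ≢ y)) ⊎ (x ≡ z))))

OrderFamily : Set → Set₁
OrderFamily U = List U → Rel U 0ℓ

IsTotalOrderFamily : {U : Set} → OrderFamily U → Set
IsTotalOrderFamily ⪯ = ∀ σ → IsTotalOrder _≡_ (⪯ σ)

Conforms : {U : Set} → PagingAlg U → OrderFamily U → Set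
Conforms A ⪯ = ∀ τ z k x y →
  x ∈ A k τ → ¬ Out A k τ z x → Out A k τ z y → ⪯ (τ ∷ʳ z) x y

Monotone : {U : Set} → OrderFamily U → Set
Monotone ⪯ = ∀ σ x y z → x ∈ σ → y ∈ σ → z ∈ σ → y ≢ z →
  ⪯ σ x y → ⪯ (σ ∷ʳ z) x y

SelfSimilar : {U : Set} → OrderFamily U → Set
SelfSimilar ⪯ = ∀ σ (X : Subset _) x y →
  x ∈ restrict σ X → y ∈ restrict σ X → ⪯ (restrict σ X) x y → ⪯ σ x y

Stable : {U : Set} → PagingAlg U → Set
Stable A = ∀ τ X z → X z ≡ true → ∀ a b → b ≥ 1 → a > b →
  (∃[ y ] (Out A b (restrict τ X) z y × (y ∈ A a (τ ∷ʳ z)))) →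
  ∀ x → x ∈ A b (restrict τ X ∷ʳ z) → x ∈ A a (τ ∷ʳ z)

-- Call u displaced after ρ (cache size k) if u was requested in ρ but is no
-- longer cached.  A displaced item is preceded in ⪯_ρ by k − 1 cached rivals:
-- by conformity, the items that stayed when it (or a rival) was evicted, and
-- later requests keep the order among requested items.  So the cache has room
-- for at most one outsider besides the rivals.
--
-- For stability, let x stay and y be evicted when A_b serves z after σ = τ[X].
-- Then x ⪯ y, in ⪯_{σz} by conformity and hence in ⪯_{τz} and ⪯_τ.  If A_a
-- did not keep x, then x would be displaced after τ with a − 1 ≥ b rivals, none
-- of them y; and each way of serving z fails: a hit needs z as a second
-- outsider (z is displaced after σ for cache b, which puts x ⪯ z), a fetch
-- needs a non-full cache, and an eviction either evicts a rival, contradicting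
-- x ⪯ y, or evicts the only outsider y.

module Submission where

open import Defs
open import Level using (0ℓ)
open import Relation.Binary.Core using (Rel)
open import Relation.Binary.Structures using (IsStrictTotalOrder; IsTotalOrder)
open import Relation.Binary.Definitions using (DecidableEquality)
open import Relation.Binary.PropositionalEquality using (_≡_; refl; sym; cong; cong₂; subst; _≢_; module ≡-Reasoning)
open import Data.Nat using (ℕ; suc; _≤_; _<_; _≥_; z≤n; s≤s)
open import Data.Nat.Properties using (≤-trans; <⇒≤; <⇒≱; n≮n; m≤n⇒m<n∨m≡n; module ≤-Reasoning)
open import Data.Bool using (true; false; T)
open import Data.Bool.Properties using (T-≡)
open import Data.List using (List; []; _∷_; _∷ʳ_; [_]; _++_; length; filter; filterᵇ)
open import Data.List.Properties using (filter-++; filter-all; filter-none; filter-notAll; ++-identityʳ)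
open import Data.List.Reverse using (Reverse; []; _∶_∶ʳ_; reverseView)
open import Data.List.Membership.Propositional using (_∈_; _∉_; lose)
open import Data.List.Membership.Propositional.Properties using (∈-++⁺ˡ; ∈-++⁺ʳ; ∈-++⁻; ∈-filter⁺; ∈-filter⁻)
import Data.List.Membership.DecPropositional as DecMembership
open import Data.List.Relation.Binary.Subset.Propositional using (_⊆_)
open import Data.List.Relation.Unary.Any using (here; there)
import Data.List.Relation.Unary.All as All
open import Data.List.Relation.Unary.All.Properties using (¬Any⇒All¬)
open import Data.List.Relation.Unary.AllPairs using (_∷_)
open import Data.List.Relation.Unary.Unique.Propositional using (Unique)
import Data.List.Relation.Unary.Unique.Propositional.Properties as Unique
open import Data.Product using (_×_; _,_; proj₁; proj₂)
open import Data.Sum as Sum using (_⊎_; inj₁; inj₂)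
open import Data.Empty using (⊥; ⊥-elim)
open import Function.Base using (id; _∘_)
open import Function.Bundles using (Equivalence; _⇔_)
open import Relation.Nullary using (yes; no; ¬?; contradiction)
open import Relation.Nullary.Decidable using (T?; isYes; fromWitness; toWitness)

open Equivalence using (to; from)

module _ {U : Set} where

  ∈-∷ʳ⁻ : ∀ {xs : List U} {v w} → v ∈ xs ∷ʳ w → v ≢ w → v ∈ xs
  ∈-∷ʳ⁻ {xs} v∈ v≢w = Sum.[ id , (λ { (here v≡w) → contradiction v≡w v≢w }) ]′ (∈-++⁻ xs v∈)

  restrict≡filterᵇ : (xs : List U) (X : Subset U) → restrict xs X ≡ filterᵇ X xs
  restrict≡filterᵇ [] X = refl
  restrict≡filterᵇ (x ∷ xs) X with X x
  ... | true  = cong (x ∷_) (restrict≡filterᵇ xs X)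
  ... | false = restrict≡filterᵇ xs X

module _ {U : Set} {X : Subset U} where

  restrict-⊆ : ∀ {xs : List U} → restrict xs X ⊆ xs
  restrict-⊆ {xs} v∈ = proj₁ (∈-filter⁻ (T? ∘ X) (subst (_ ∈_) (restrict≡filterᵇ xs X) v∈))

  ∈-restrict⁺ : ∀ {xs : List U} {v} → T (X v) → v ∈ xs → v ∈ restrict xs X
  ∈-restrict⁺ {xs} Xv v∈ = subst (_ ∈_) (sym (restrict≡filterᵇ xs X)) (∈-filter⁺ (T? ∘ X) v∈ Xv)

  restrict-∷ʳ : ∀ (xs : List U) {z} → T (X z) → restrict (xs ∷ʳ z) X ≡ restrict xs X ∷ʳ z
  restrict-∷ʳ xs {z} Xz = begin
    restrict (xs ∷ʳ z) X             ≡⟨ restrict≡filterᵇ (xs ∷ʳ z) X ⟩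
    filterᵇ X (xs ++ [ z ])          ≡⟨ filter-++ (T? ∘ X) xs [ z ] ⟩
    filterᵇ X xs ++ filterᵇ X [ z ]  ≡⟨ cong₂ _++_ (sym (restrict≡filterᵇ xs X))
                                                    (filter-all (T? ∘ X) (Xz All.∷ All.[])) ⟩
    restrict xs X ∷ʳ z               ∎
    where open ≡-Reasoning

module _ {U : Set} (_≟_ : DecidableEquality U) where

  open DecMembership _≟_ using (_∈?_)

  unique-⊆⇒length-≤ : ∀ {S C : List U} → Unique S → S ⊆ C → length S ≤ length C
  unique-⊆⇒length-≤ {[]} _ _ = z≤n
  unique-⊆⇒length-≤ {s ∷ S} {C} (s∉S ∷ S-unique) S⊆C = begin-strict
    length S                 ≤⟨ unique-⊆⇒length-≤ S-unique S⊆C∖s ⟩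
    length (filter P? C)     <⟨ filter-notAll P? C (lose (S⊆C (here refl)) (λ s≢s → s≢s refl)) ⟩
    length C                 ∎
    where
    open ≤-Reasoning
    P? = λ v → ¬? (v ≟ s)
    S⊆C∖s : S ⊆ filter P? C
    S⊆C∖s v∈S = ∈-filter⁺ P? (S⊆C (there v∈S)) (λ v≡s → All.lookup s∉S v∈S (sym v≡s))

  occurs : List U → Subset U
  occurs ρ v = isYes (v ∈? ρ)

  restrict-occurs-∷ʳ : ∀ {ρ : List U} {w} → w ∉ ρ → restrict (ρ ∷ʳ w) (occurs ρ) ≡ ρ
  restrict-occurs-∷ʳ {ρ} {w} w∉ρ = begin
    restrict (ρ ∷ʳ w) X              ≡⟨ restrict≡filterᵇ (ρ ∷ʳ w) X ⟩
    filterᵇ X (ρ ++ [ w ])           ≡⟨ filter-++ (T? ∘ X) ρ [ w ] ⟩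
    filterᵇ X ρ ++ filterᵇ X [ w ]   ≡⟨ cong₂ _++_
                                          (filter-all (T? ∘ X) (All.tabulate λ {v} → fromWitness {a? = v ∈? ρ}))
                                          (filter-none (T? ∘ X) ((w∉ρ ∘ toWitness {a? = w ∈? ρ}) All.∷ All.[])) ⟩
    ρ ++ []                          ≡⟨ ++-identityʳ ρ ⟩
    ρ                                ∎
    where
    open ≡-Reasoning
    X : Subset U
    X = occurs ρ

module OrderFamilyProperties {U : Set} (_≟_ : DecidableEquality U) {⪯ : OrderFamily U}
  (isTotal : IsTotalOrderFamily ⪯) (monotone : Monotone ⪯) (selfSimilar : SelfSimilar ⪯) where

  open DecMembership _≟_ using (_∈?_)

  module Total (ρ : List U) = IsTotalOrder (isTotal ρ)

  -- A repeated request is handled by monotonicity, a first request by self-similarity.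
  ⪯-∷ʳ⁺ : ∀ {ρ w p q} → p ∈ ρ → q ∈ ρ → q ≢ w → ⪯ ρ p q → ⪯ (ρ ∷ʳ w) p q
  ⪯-∷ʳ⁺ {ρ} {w} {p} {q} p∈ρ q∈ρ q≢w p⪯q with w ∈? ρ
  ... | yes w∈ρ = monotone ρ p q w p∈ρ q∈ρ w∈ρ q≢w p⪯q
  ... | no w∉ρ  = subst (λ σ → p ∈ σ → q ∈ σ → ⪯ σ p q → ⪯ (ρ ∷ʳ w) p q)
                        (restrict-occurs-∷ʳ _≟_ w∉ρ) (selfSimilar (ρ ∷ʳ w) (occurs _≟_ ρ) p q)
                        p∈ρ q∈ρ p⪯q

  ⪯-∷ʳ⁻ : ∀ {ρ w p q} → p ∈ ρ → q ∈ ρ → p ≢ w → ⪯ (ρ ∷ʳ w) p q → ⪯ ρ p q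
  ⪯-∷ʳ⁻ {ρ} {w} {p} {q} p∈ρ q∈ρ p≢w p⪯q with Total.total ρ p q
  ... | inj₁ p⪯q′ = p⪯q′
  ... | inj₂ q⪯p  = Total.reflexive ρ (Total.antisym (ρ ∷ʳ w) p⪯q (⪯-∷ʳ⁺ q∈ρ p∈ρ p≢w q⪯p))

module LazyCache {U : Set} (_≟_ : DecidableEquality U) {A : PagingAlg U} (lazy : Lazy A)
  (k : ℕ) (k≥1 : k ≥ 1) where

  open DecMembership _≟_ using (_∈?_)
  private module L = Lazy lazy

  data Response (ρ : List U) (w : U) : Set where
    hit   : w ∈ A k ρ → (∀ v → (v ∈ A k (ρ ∷ʳ w)) ⇔ (v ∈ A k ρ)) → Response ρ w
    fetch : w ∉ A k ρ → length (A k ρ) < k →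
            (∀ v → (v ∈ A k (ρ ∷ʳ w)) ⇔ ((v ∈ A k ρ) ⊎ (v ≡ w))) → Response ρ w
    evict : w ∉ A k ρ → length (A k ρ) ≡ k → ∀ e → e ∈ A k ρ → e ∉ A k (ρ ∷ʳ w) →
            (∀ v → (v ∈ A k (ρ ∷ʳ w)) ⇔ (((v ∈ A k ρ) × (v ≢ e)) ⊎ (v ≡ w))) → Response ρ w

  private
    response-≤ : ∀ ρ w → length (A k ρ) ≤ k → Response ρ w
    response-≤ ρ w size≤ with w ∈? A k ρ
    ... | yes w∈ = hit w∈ (L.hit k k≥1 ρ w w∈)
    ... | no w∉ with m≤n⇒m<n∨m≡n size≤
    ... | inj₁ size< = fetch w∉ size< (L.missNotFull k k≥1 ρ w w∉ size<)
    ... | inj₂ full with L.missFull k k≥1 ρ w w∉ full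
    ... | e , e∈ , after = evict w∉ full e e∈ e∉ after
      where
      e∉ : e ∉ A k (ρ ∷ʳ w)
      e∉ e∈′ = Sum.[ (λ (_ , e≢e) → e≢e refl) , (λ e≡w → w∉ (subst (_∈ A k ρ) e≡w e∈)) ]′
                   (to (after e) e∈′)

  cache-size-≤ : ∀ ρ → length (A k ρ) ≤ k
  cache-size-≤ ρ = go (reverseView ρ)
    where
    step : ∀ {ρ} w → length (A k ρ) ≤ k → length (A k (ρ ∷ʳ w)) ≤ k
    step {ρ} w size≤ with response-≤ ρ w size≤
    ... | hit _ after = ≤-trans (unique-⊆⇒length-≤ _≟_ (L.unique k _) (to (after _))) size≤
    ... | fetch _ size< after =
      ≤-trans (unique-⊆⇒length-≤ _≟_ (L.unique k _) (Sum.[ there , here ]′ ∘ to (after _))) size<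
    ... | evict _ full e e∈ _ after =
      ≤-trans (unique-⊆⇒length-≤ _≟_ (L.unique k _) (Sum.[ there ∘ survivor , here ]′ ∘ to (after _)))
              (subst (length (filter P? (A k ρ)) <_) full
                     (filter-notAll P? (A k ρ) (lose e∈ (λ e≢e → e≢e refl))))
      where
      P? = λ v → ¬? (v ≟ e)
      survivor : ∀ {v} → (v ∈ A k ρ) × (v ≢ e) → v ∈ filter P? (A k ρ)
      survivor (v∈ , v≢e) = ∈-filter⁺ P? v∈ v≢e
    go : ∀ {ρ} → Reverse ρ → length (A k ρ) ≤ k
    go [] = subst (λ c → length c ≤ k) (sym (L.initial k)) z≤n
    go (_ ∶ r ∶ʳ w) = step w (go r)

  response : ∀ ρ w → Response ρ w
  response ρ w = response-≤ ρ w (cache-size-≤ ρ)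

  requested-cached : ∀ ρ w → w ∈ A k (ρ ∷ʳ w)
  requested-cached ρ w with response ρ w
  ... | hit w∈ after = from (after w) w∈
  ... | fetch _ _ after = from (after w) (inj₂ refl)
  ... | evict _ _ _ _ _ after = from (after w) (inj₂ refl)

  cached-∷ʳ⁻ : ∀ {ρ w v} → v ∈ A k (ρ ∷ʳ w) → v ≢ w → v ∈ A k ρ
  cached-∷ʳ⁻ {ρ} {w} {v} v∈ v≢w with response ρ w
  ... | hit _ after = to (after v) v∈
  ... | fetch _ _ after = Sum.[ id , ⊥-elim ∘ v≢w ]′ (to (after v) v∈)
  ... | evict _ _ _ _ _ after = Sum.[ proj₁ , ⊥-elim ∘ v≢w ]′ (to (after v) v∈)

  hit-⊆ : ∀ {ρ w} → w ∈ A k ρ → A k ρ ⊆ A k (ρ ∷ʳ w)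
  hit-⊆ {ρ} {w} w∈ with response ρ w
  ... | hit _ after = from (after _)
  ... | fetch w∉ _ _ = contradiction w∈ w∉
  ... | evict w∉ _ _ _ _ _ = contradiction w∈ w∉

  cached⇒requested : ∀ {ρ} → A k ρ ⊆ ρ
  cached⇒requested {ρ} = go (reverseView ρ)
    where
    go : ∀ {ρ} → Reverse ρ → A k ρ ⊆ ρ
    go [] v∈ with () ← subst (_ ∈_) (L.initial k) v∈
    go (ρ ∶ r ∶ʳ w) {v} v∈ with v ≟ w
    ... | yes refl = ∈-++⁺ʳ ρ (here refl)
    ... | no v≢w = ∈-++⁺ˡ (go r (cached-∷ʳ⁻ v∈ v≢w))

module ConformingCache {U : Set} (_≟_ : DecidableEquality U) {A : PagingAlg U} (lazy : Lazy A)
  {⪯ : OrderFamily U} (isTotal : IsTotalOrderFamily ⪯) (monotone : Monotone ⪯)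
  (selfSimilar : SelfSimilar ⪯) (conforms : Conforms A ⪯) (k : ℕ) (k≥1 : k ≥ 1) where

  open DecMembership _≟_ using (_∈?_)
  open OrderFamilyProperties _≟_ isTotal monotone selfSimilar public
  open LazyCache _≟_ lazy k k≥1 public
  private module L = Lazy lazy

  kept-⪯-evicted : ∀ {ρ w v u} → v ∈ A k ρ → v ∈ A k (ρ ∷ʳ w) → u ∈ A k ρ → u ∉ A k (ρ ∷ʳ w) →
                   ⪯ (ρ ∷ʳ w) v u
  kept-⪯-evicted v∈ v∈′ u∈ u∉′ = conforms _ _ k _ _ v∈ (λ out → proj₂ out v∈′) (u∈ , u∉′)

  record Displaced (ρ : List U) (u : U) : Set where
    field
      rivals         : List U
      rivals-unique  : Unique rivals
      rivals-many    : k ≤ suc (length rivals)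
      rivals-cached  : rivals ⊆ A k ρ
      rivals-⪯       : ∀ {v} → v ∈ rivals → ⪯ ρ v u
      rivals-≢       : ∀ {v} → v ∈ rivals → v ≢ u

  displaced-by-survivors : ∀ {ρ w e u} → length (A k ρ) ≡ k →
    (∀ {v} → v ∈ A k ρ → v ≢ e → v ∈ A k (ρ ∷ʳ w)) → u ∉ A k (ρ ∷ʳ w) →
    (∀ {v} → v ∈ A k ρ → v ∈ A k (ρ ∷ʳ w) → ⪯ (ρ ∷ʳ w) v u) → Displaced (ρ ∷ʳ w) u
  displaced-by-survivors {ρ} {w} {e} {u} full survives u∉ kept⪯u = record
    { rivals        = S
    ; rivals-unique = Unique.filter⁺ P? (L.unique k ρ)
    ; rivals-many   = subst (_≤ suc (length S)) full (unique-⊆⇒length-≤ _≟_ (L.unique k ρ) cache⊆e∷S)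
    ; rivals-cached = proj₂ ∘ survivor
    ; rivals-⪯      = λ v∈S → let (v∈ , v∈′) = survivor v∈S in kept⪯u v∈ v∈′
    ; rivals-≢      = λ v∈S v≡u → u∉ (subst (_∈ A k (ρ ∷ʳ w)) v≡u (proj₂ (survivor v∈S)))
    }
    where
    P? = _∈? A k (ρ ∷ʳ w)
    S : List U
    S = filter P? (A k ρ)
    survivor : ∀ {v} → v ∈ S → (v ∈ A k ρ) × (v ∈ A k (ρ ∷ʳ w))
    survivor = ∈-filter⁻ P? {xs = A k ρ}
    cache⊆e∷S : A k ρ ⊆ e ∷ S
    cache⊆e∷S {v} v∈ with v ≟ e
    ... | yes v≡e = here v≡e
    ... | no v≢e = there (∈-filter⁺ P? v∈ (survives v∈ v≢e))

  displaced-∷ʳ : ∀ {ρ w u} → u ∈ ρ → u ≢ w → (D : Displaced ρ u) →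
                 Displaced.rivals D ⊆ A k (ρ ∷ʳ w) → Displaced (ρ ∷ʳ w) u
  displaced-∷ʳ u∈ρ u≢w D rivals-kept = record
    { rivals        = rivals
    ; rivals-unique = rivals-unique
    ; rivals-many   = rivals-many
    ; rivals-cached = rivals-kept
    ; rivals-⪯      = λ v∈ → ⪯-∷ʳ⁺ (cached⇒requested (rivals-cached v∈)) u∈ρ u≢w (rivals-⪯ v∈)
    ; rivals-≢      = rivals-≢
    }
    where open Displaced D

  evicted-displaced : ∀ {ρ w u} → u ∈ A k ρ → u ∉ A k (ρ ∷ʳ w) → Displaced (ρ ∷ʳ w) u
  evicted-displaced {ρ} {w} u∈ u∉ with response ρ w
  ... | hit _ after = contradiction (from (after _) u∈) u∉
  ... | fetch _ _ after = contradiction (from (after _) (inj₁ u∈)) u∉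
  ... | evict _ full _ _ _ after =
    displaced-by-survivors full (λ v∈ v≢e → from (after _) (inj₁ (v∈ , v≢e))) u∉
                           (λ v∈ v∈′ → kept-⪯-evicted v∈ v∈′ u∈ u∉)

  module _ {ρ w u} (u∈ρ : u ∈ ρ) (u≢w : u ≢ w) (D : Displaced ρ u) where
    open Displaced D

    displaced-step : u ∉ A k (ρ ∷ʳ w) → Displaced (ρ ∷ʳ w) u
    displaced-step u∉ with response ρ w
    ... | hit _ after = displaced-∷ʳ u∈ρ u≢w D (from (after _) ∘ rivals-cached)
    ... | fetch _ _ after = displaced-∷ʳ u∈ρ u≢w D (from (after _) ∘ inj₁ ∘ rivals-cached)
    ... | evict _ full e e∈ e∉ after with e ∈? rivals
    ...   | yes e∈R =
      displaced-by-survivors full (λ v∈ v≢e → from (after _) (inj₁ (v∈ , v≢e))) u∉ λ v∈ v∈′ →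
        Total.trans (ρ ∷ʳ w) (kept-⪯-evicted v∈ v∈′ e∈ e∉)
                             (⪯-∷ʳ⁺ (cached⇒requested e∈) u∈ρ u≢w (rivals-⪯ e∈R))
    ...   | no e∉R = displaced-∷ʳ u∈ρ u≢w D λ v∈R →
              from (after _) (inj₁ (rivals-cached v∈R , λ v≡e → e∉R (subst (_∈ rivals) v≡e v∈R)))

  displaced : ∀ {ρ u} → u ∈ ρ → u ∉ A k ρ → Displaced ρ u
  displaced {ρ} = go (reverseView ρ)
    where
    go : ∀ {ρ} → Reverse ρ → ∀ {u} → u ∈ ρ → u ∉ A k ρ → Displaced ρ u
    go [] ()
    go (ρ ∶ r ∶ʳ w) {u} u∈ u∉ with u ≟ w
    ... | yes refl = contradiction (requested-cached ρ u) u∉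
    ... | no u≢w with u ∈? A k ρ
    ...   | yes u∈A = evicted-displaced u∈A u∉
    ...   | no u∉A = displaced-step (∈-∷ʳ⁻ u∈ u≢w) u≢w (go r (∈-∷ʳ⁻ u∈ u≢w) u∉A) u∉

  module _ {ρ u} (D : Displaced ρ u) where
    open Displaced D

    rival-not-above : ∀ {v} → ⪯ ρ u v → v ∉ rivals
    rival-not-above u⪯v v∈R = rivals-≢ v∈R (Total.antisym ρ (rivals-⪯ v∈R) u⪯v)

    outsider-fills : ∀ {p} → p ∈ A k ρ → p ∉ rivals → k ≤ length (A k ρ)
    outsider-fills {p} p∈ p∉R =
      ≤-trans rivals-many (unique-⊆⇒length-≤ _≟_ (¬Any⇒All¬ rivals p∉R ∷ rivals-unique) p∷R⊆)
      where
      p∷R⊆ : p ∷ rivals ⊆ A k ρ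
      p∷R⊆ (here refl) = p∈
      p∷R⊆ (there v∈R) = rivals-cached v∈R

    outsider-unique : ∀ {p q} → p ∈ A k ρ → q ∈ A k ρ → p ∉ rivals → q ∉ rivals → p ≡ q
    outsider-unique {p} {q} p∈ q∈ p∉R q∉R with p ≟ q
    ... | yes p≡q = p≡q
    ... | no p≢q = contradiction (≤-trans (s≤s rivals-many) (≤-trans
                     (unique-⊆⇒length-≤ _≟_ pq∷R-unique pq∷R⊆) (cache-size-≤ ρ))) (n≮n k)
      where
      pq∷R-unique : Unique (p ∷ q ∷ rivals)
      pq∷R-unique = (p≢q All.∷ ¬Any⇒All¬ rivals p∉R) ∷ ¬Any⇒All¬ rivals q∉R ∷ rivals-unique
      pq∷R⊆ : p ∷ q ∷ rivals ⊆ A k ρ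
      pq∷R⊆ (here refl) = p∈
      pq∷R⊆ (there (here refl)) = q∈
      pq∷R⊆ (there (there v∈R)) = rivals-cached v∈R

    cached-⪯-displaced : ∀ {p q} → p ∈ A k ρ → q ∈ A k ρ → p ≢ q → ⪯ ρ p q → ⪯ ρ p u
    cached-⪯-displaced {p} {q} p∈ q∈ p≢q p⪯q with p ∈? rivals | q ∈? rivals
    ... | yes p∈R | _ = rivals-⪯ p∈R
    ... | no _ | yes q∈R = Total.trans ρ p⪯q (rivals-⪯ q∈R)
    ... | no p∉R | no q∉R = contradiction (outsider-unique p∈ q∈ p∉R q∉R) p≢q

module Stability {U : Set} (_≟_ : DecidableEquality U) {A : PagingAlg U} (lazy : Lazy A)
  {⪯ : OrderFamily U} (isTotal : IsTotalOrderFamily ⪯) (monotone : Monotone ⪯)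
  (selfSimilar : SelfSimilar ⪯) (conforms : Conforms A ⪯)
  {τ : List U} {X : Subset U} {z : U} (z∈X : T (X z)) {a b : ℕ} (b≥1 : b ≥ 1) (b<a : b < a)
  {y : U} (y∈B : y ∈ A b (restrict τ X)) (y∉B′ : y ∉ A b (restrict τ X ∷ʳ z))
  (y∈A′ : y ∈ A a (τ ∷ʳ z)) where

  open DecMembership _≟_ using (_∈?_)
  open OrderFamilyProperties _≟_ isTotal monotone selfSimilar
  module α = ConformingCache _≟_ lazy isTotal monotone selfSimilar conforms a (≤-trans b≥1 (<⇒≤ b<a))
  module β = ConformingCache _≟_ lazy isTotal monotone selfSimilar conforms b b≥1

  σ : List U
  σ = restrict τ X

  z∉B : z ∉ A b σ
  z∉B z∈B = y∉B′ (β.hit-⊆ z∈B y∈B)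

  y≢z : y ≢ z
  y≢z refl = z∉B y∈B

  y∈A : y ∈ A a τ
  y∈A = α.cached-∷ʳ⁻ y∈A′ y≢z

  y∈σ : y ∈ σ
  y∈σ = β.cached⇒requested y∈B

  ⪯-restrict-∷ʳ : ∀ {p q} → p ∈ σ → q ∈ σ → ⪯ (σ ∷ʳ z) p q → ⪯ (τ ∷ʳ z) p q
  ⪯-restrict-∷ʳ {p} {q} p∈σ q∈σ =
    subst (λ s → p ∈ s → q ∈ s → ⪯ s p q → ⪯ (τ ∷ʳ z) p q) (restrict-∷ʳ τ z∈X)
          (selfSimilar (τ ∷ʳ z) X p q) (∈-++⁺ˡ p∈σ) (∈-++⁺ˡ q∈σ)

  module _ {x} (x∈B : x ∈ A b σ) (x∈B′ : x ∈ A b (σ ∷ʳ z)) (x≢z : x ≢ z) where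

    x≢y : x ≢ y
    x≢y refl = y∉B′ x∈B′

    x∈σ : x ∈ σ
    x∈σ = β.cached⇒requested x∈B

    x∈τ : x ∈ τ
    x∈τ = restrict-⊆ x∈σ

    x⪯y-σz : ⪯ (σ ∷ʳ z) x y
    x⪯y-σz = β.kept-⪯-evicted x∈B x∈B′ y∈B y∉B′

    x⪯y-τz : ⪯ (τ ∷ʳ z) x y
    x⪯y-τz = ⪯-restrict-∷ʳ x∈σ y∈σ x⪯y-σz

    x⪯y-τ : ⪯ τ x y
    x⪯y-τ = ⪯-∷ʳ⁻ x∈τ (restrict-⊆ y∈σ) x≢z x⪯y-τz

    x⪯z-τ : z ∈ τ → ⪯ τ x z
    x⪯z-τ z∈τ = selfSimilar τ X x z x∈σ z∈σ
      (β.cached-⪯-displaced (β.displaced z∈σ z∉B) x∈B y∈B x≢y (⪯-∷ʳ⁻ x∈σ y∈σ x≢z x⪯y-σz))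
      where
      z∈σ : z ∈ σ
      z∈σ = ∈-restrict⁺ z∈X z∈τ

    x∉A : x ∉ A a (τ ∷ʳ z) → x ∉ A a τ
    x∉A x∉A′ x∈A = x≢y (Total.antisym (τ ∷ʳ z) x⪯y-τz (α.kept-⪯-evicted y∈A y∈A′ x∈A x∉A′))

    module _ (x∉A′ : x ∉ A a (τ ∷ʳ z)) where
      D : α.Displaced τ x
      D = α.displaced x∈τ (x∉A x∉A′)

      open α.Displaced D

      y∉R : y ∉ rivals
      y∉R = α.rival-not-above D x⪯y-τ

      not-evicted : ⊥
      not-evicted with α.response τ z
      ... | α.hit z∈A _ = y≢z (sym (α.outsider-unique D z∈A y∈A z∉R y∉R))
        where
        z∉R : z ∉ rivals
        z∉R = α.rival-not-above D (x⪯z-τ (α.cached⇒requested z∈A))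
      ... | α.fetch _ size< _ = <⇒≱ size< (α.outsider-fills D y∈A y∉R)
      ... | α.evict _ _ e e∈A e∉A′ _ with e ∈? rivals
      ...   | yes e∈R = x≢y (Total.antisym (τ ∷ʳ z) x⪯y-τz (Total.trans (τ ∷ʳ z)
                (α.kept-⪯-evicted y∈A y∈A′ e∈A e∉A′)
                (⪯-∷ʳ⁺ (α.cached⇒requested e∈A) x∈τ x≢z (rivals-⪯ e∈R))))
      ...   | no e∉R = e∉A′ (subst (_∈ A a (τ ∷ʳ z)) (sym (α.outsider-unique D e∈A y∈A e∉R y∉R)) y∈A′)

    kept : x ∈ A a (τ ∷ʳ z)
    kept with x ∈? A a (τ ∷ʳ z)
    ... | yes x∈A′ = x∈A′
    ... | no x∉A′ = ⊥-elim (not-evicted x∉A′)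

  retained : ∀ x → x ∈ A b (σ ∷ʳ z) → x ∈ A a (τ ∷ʳ z)
  retained x x∈B′ with x ≟ z
  ... | yes refl = α.requested-cached τ x
  ... | no x≢z = kept (β.cached-∷ʳ⁻ x∈B′ x≢z) x∈B′ x≢z

theorem23 : {U : Set} (_<U_ : Rel U 0ℓ) → IsStrictTotalOrder _≡_ _<U_ →
            (A : PagingAlg U) → Lazy A →
            (⪯ : OrderFamily U) → IsTotalOrderFamily ⪯ →
            Conforms A ⪯ → Monotone ⪯ → SelfSimilar ⪯ →
            Stable A
theorem23 _ isStrictTotal A lazy ⪯ isTotal conforms monotone selfSimilar
          τ X z z∈X a b b≥1 b<a (y , (y∈B , y∉B′) , y∈A′) =
  Stability.retained (IsStrictTotalOrder._≟_ isStrictTotal) lazy isTotal monotone selfSimilar conforms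
                     (from T-≡ z∈X) b≥1 b<a y∈B y∉B′ y∈A′
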